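{- Let $G$ be a finite permutation group and let $K$ be a normal subgroup of $G$ such that $G/K$ acts faithfully on the set of $K$-orbits. If $G/K$, in its action on the $K$-orbits, contains a semiregular element $gK$ whose order is coprime to $|K|$, then $G$ contains a semiregular element of order equal to the order of $gK$.
   Context: A permutation (or element of a permutation group) is semiregular if the group it generates has no non-identity element fixing a point. -}

module Defs where

open import Level using (Level; suc; _⊔_) renaming (zero to lzero)
open import Data.Nat using (ℕ; zero; suc; _<_)
open import Data.Fin using (Fin)
open import Data.Fin.Permutation using (Permutation′; _⟨$⟩ʳ_; _≈_; id; flip; _∘ₚ_)
open import Data.List using (List; length)
open import Data.List.Relation.Unary.All using (All)
open import Data.List.Relation.Unary.Any using (Any)
open import Data.List.Relation.Unary.AllPairs using (AllPairs)
open import Data.Product using (Σ; ∃; _×_; _,_)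
open import Relation.Binary.PropositionalEquality using (_≡_)
open import Relation.Nullary using (¬_)

PermSet : ℕ → Set₁
PermSet n = Permutation′ n → Set

record IsPermGroup {n : ℕ} (G : PermSet n) : Set where
  field
    resp  : ∀ {π ρ} → π ≈ ρ → G π → G ρ
    ∈-id  : G id
    ∈-∘   : ∀ {π ρ} → G π → G ρ → G (π ∘ₚ ρ)
    ∈-inv : ∀ {π} → G π → G (flip π)

record IsNormalSubgroup {n : ℕ} (K G : PermSet n) : Set where
  field
    isGroup : IsPermGroup K
    sub     : ∀ {k} → K k → G k
    normal  : ∀ {g k} → G g → K k → K (flip g ∘ₚ (k ∘ₚ g))

pow : ∀ {n} → Permutation′ n → ℕ → Permutation′ n
pow π zero    = id
pow π (suc m) = π ∘ₚ pow π m

HasSize : ∀ {n} → PermSet n → ℕ → Set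
HasSize {n} S c = Σ (List (Permutation′ n)) λ xs →
  All S xs × AllPairs (λ π ρ → ¬ (π ≈ ρ)) xs ×
  (∀ π → S π → Any (π ≈_) xs) × length xs ≡ c

IsLeastPos : (ℕ → Set) → ℕ → Set
IsLeastPos P m = 0 < m × P m × (∀ j → 0 < j → j < m → ¬ P j)

SameOrbit : ∀ {n} → PermSet n → Fin n → Fin n → Set
SameOrbit K x y = ∃ λ k → K k × k ⟨$⟩ʳ x ≡ y

FixesOrbit : ∀ {n} → PermSet n → Permutation′ n → Fin n → Set
FixesOrbit K π x = SameOrbit K (π ⟨$⟩ʳ x) x

TrivialOnOrbits : ∀ {n} → PermSet n → Permutation′ n → Set
TrivialOnOrbits K π = ∀ x → FixesOrbit K π x

FaithfulOnOrbits : ∀ {n} → PermSet n → PermSet n → Set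
FaithfulOnOrbits K G = ∀ g → G g → TrivialOnOrbits K g → K g

-- gK is semiregular in the action on K-orbits: every element of ⟨gK⟩
-- (i.e. every power g^i K) fixing some K-orbit acts trivially.
SemiregularOnOrbits : ∀ {n} → PermSet n → Permutation′ n → Set
SemiregularOnOrbits K g = ∀ i x → FixesOrbit K (pow g i) x → TrivialOnOrbits K (pow g i)

OrderOnOrbits : ∀ {n} → PermSet n → Permutation′ n → ℕ → Set
OrderOnOrbits K g = IsLeastPos (λ j → TrivialOnOrbits K (pow g j))

Semiregular : ∀ {n} → Permutation′ n → Set
Semiregular h = ∀ i x → pow h i ⟨$⟩ʳ x ≡ x → pow h i ≈ id

Order : ∀ {n} → Permutation′ n → ℕ → Set
Order h = IsLeastPos (λ j → pow h j ≈ id)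

module Submission where

-- By faithfulness, m is the least positive exponent with g^m ∈ K.
-- Let t be the order of g^m ∈ K.  Lagrange's theorem for ⟨g^m⟩ ≤ K gives
-- t ∣ k, so m and t are coprime.  Put h = g^t.  If h^i ∈ K then m ∣ i t,
-- hence m ∣ i; with h^m = (g^m)^t = 1 this shows that h has order m and
-- ⟨h⟩ ∩ K = 1.  If h^i = g^(i t) fixes a point, it fixes that point's
-- K-orbit, so it acts trivially on the orbits (gK is semiregular), lies in K
-- (faithfulness), and therefore h^i = 1: h is semiregular.

open import Defs
open import Level using (0ℓ)
open import Data.Nat using (ℕ; zero; suc; _+_; _*_; _∸_; _≤_; _<_; NonZero; >-nonZero)
open import Data.Nat.Properties
  using ( m+[n∸m]≡n; m<n⇒0<n∸m; *-comm; n<1+n; <⇒≤; n≢0⇒n>0; _≟_; _<?_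
        ; ≤-<-trans; m∸n≤m; m<n+m; m∸n+n≡m; <⇒≱)
open import Data.Nat.Divisibility using (_∣_; divides; m%n≡0⇒n∣m; ∣-trans; ∣⇒≤; _∣0; ∣m∣n⇒∣m+n; ∣-refl)
open import Data.Nat.DivMod using (_%_; _/_; m≡m%n+[m/n]*n; m%n<n)
open import Data.Nat.Coprimality using (Coprime; coprime-divisor)
open import Data.Nat.Induction using (<-wellFounded)
open import Induction.WellFounded using (Acc; acc)
open import Data.Fin using (Fin; zero; suc; toℕ; fromℕ<)
import Data.Fin.Properties as Finₚ
open import Data.Fin.Permutation
  using (Permutation′; _⟨$⟩ʳ_; _⟨$⟩ˡ_; id; flip; _∘ₚ_; inverseˡ; inverseʳ) renaming (_≈_ to _≈ₚ_)
open import Data.List using (List; []; _∷_; length; _++_; lookup; applyUpTo; filter)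
open import Data.List.Properties using (length-++; length-applyUpTo)
import Data.List.Relation.Unary.All as All
import Data.List.Relation.Unary.Any as Any
open import Data.List.Relation.Unary.AllPairs as AllPairs using (AllPairs; []; _∷_)
import Data.List.Membership.Propositional.Properties as Memₚ
open import Data.Product using (Σ; ∃; ∃₂; _×_; _,_; proj₁; proj₂)
open import Data.Sum using (inj₁; inj₂)
open import Data.Empty using (⊥-elim)
open import Function using (_∘_)
open import Relation.Binary using (Setoid; DecSetoid)
open import Relation.Binary.PropositionalEquality
  using (_≡_; refl; sym; trans; cong; subst; module ≡-Reasoning)
open import Relation.Nullary using (¬_; Dec; yes; no)
open import Relation.Nullary.Decidable using (_×-dec_; map′)

module Counting {a ℓ} (S : Setoid a ℓ) where
  open Setoid S using (_≈_) renaming (sym to ≈-sym)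
  open import Data.List.Membership.Setoid S using (_∈_)
  open import Data.List.Membership.Setoid.Properties using (∈-lookup; index-injective)
  open import Data.List.Relation.Unary.Unique.Setoid S using (Unique)
  open import Data.List.Relation.Binary.Subset.Setoid S using (_⊆_)

  lookup-injective : ∀ {xs} → Unique xs → ∀ {i j} → lookup xs i ≈ lookup xs j → i ≡ j
  lookup-injective (_ ∷ _) {zero} {zero} _ = refl
  lookup-injective {_ ∷ xs} (x≉ ∷ _) {zero} {suc j} x≈ =
    ⊥-elim (All.lookup x≉ (Memₚ.∈-lookup {xs = xs} j) x≈)
  lookup-injective {_ ∷ xs} (x≉ ∷ _) {suc i} {zero} ≈x =
    ⊥-elim (All.lookup x≉ (Memₚ.∈-lookup {xs = xs} i) (≈-sym ≈x))
  lookup-injective (_ ∷ u) {suc i} {suc j} eq = cong suc (lookup-injective u eq)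

  length-mono : ∀ {xs ys} → Unique xs → xs ⊆ ys → length xs ≤ length ys
  length-mono {xs} u xs⊆ys = Finₚ.injective⇒≤ {f = position} position-injective
    where
      position : Fin (length xs) → Fin _
      position i = Any.index (xs⊆ys (∈-lookup S xs i))
      position-injective : ∀ {i j} → position i ≡ position j → i ≡ j
      position-injective {i} {j} eq =
        lookup-injective u (index-injective S (xs⊆ys (∈-lookup S xs i)) (xs⊆ys (∈-lookup S xs j)) eq)

  length-cong : ∀ {xs ys} → Unique xs → Unique ys → xs ⊆ ys → ys ⊆ xs → length xs ≡ length ys
  length-cong uxs uys xs⊆ys ys⊆xs = ≤-antisym (length-mono uxs xs⊆ys) (length-mono uys ys⊆xs)
    where open import Data.Nat.Properties using (≤-antisym)

leastPositive : (P : ℕ → Set) → (∀ j → Dec (P j)) → ∀ d → 0 < d → P d → ∃ (IsLeastPos P)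
leastPositive P P? d = go d (<-wellFounded d)
  where
    go : ∀ d → Acc _<_ d → 0 < d → P d → ∃ (IsLeastPos P)
    go d (acc smaller) 0<d Pd
      with Finₚ.any? {n = d} (λ j → (0 <? toℕ j) ×-dec P? (toℕ j))
    ... | yes (j , 0<j , Pj) = go (toℕ j) (smaller (Finₚ.toℕ<n j)) 0<j Pj
    ... | no noneBelow = d , 0<d , Pd , λ j 0<j j<d Pj →
            noneBelow (fromℕ< j<d , subst (λ i → 0 < i × P i) (sym (Finₚ.toℕ-fromℕ< j<d)) (0<j , Pj))

infix 4 _≃_

-- Pointwise equality of permutations, wrapped in a record so that the two
-- permutations can be recovered from an equality proof by unification.
record _≃_ {n : ℕ} (π ρ : Permutation′ n) : Set where
  constructor pointwise
  field at : π ≈ₚ ρ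
open _≃_ public

permSetoid : ℕ → Setoid 0ℓ 0ℓ
permSetoid n = record
  { Carrier       = Permutation′ n
  ; _≈_           = _≃_
  ; isEquivalence = record
    { refl  = pointwise (λ _ → refl)
    ; sym   = λ p → pointwise (λ i → sym (at p i))
    ; trans = λ p q → pointwise (λ i → trans (at p i) (at q i))
    }
  }

module _ {n : ℕ} where

  open Setoid (permSetoid n) public using ()
    renaming (refl to ≃-refl; sym to ≃-sym; trans to ≃-trans; reflexive to ≡⇒≃)

  infix 4 _≃?_

  _≃?_ : (π ρ : Permutation′ n) → Dec (π ≃ ρ)
  π ≃? ρ = map′ pointwise at (Finₚ.all? (λ i → π ⟨$⟩ʳ i Finₚ.≟ ρ ⟨$⟩ʳ i))

  permDecSetoid : DecSetoid 0ℓ 0ℓ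
  permDecSetoid = record
    { isDecEquivalence = record { isEquivalence = Setoid.isEquivalence (permSetoid n) ; _≟_ = _≃?_ } }

  -- Note that π ∘ₚ ρ applies π first, then ρ.
  ∘ₚ-cong : {π π′ ρ ρ′ : Permutation′ n} → π ≃ π′ → ρ ≃ ρ′ → π ∘ₚ ρ ≃ π′ ∘ₚ ρ′
  ∘ₚ-cong {π′ = π′} {ρ = ρ} p q =
    pointwise (λ i → trans (cong (ρ ⟨$⟩ʳ_) (at p i)) (at q (π′ ⟨$⟩ʳ i)))

  ∘ₚ-cancelˡ : (π : Permutation′ n) {ρ σ : Permutation′ n} → π ∘ₚ ρ ≃ π ∘ₚ σ → ρ ≃ σ
  ∘ₚ-cancelˡ π {ρ} {σ} p = pointwise λ i → begin
    ρ ⟨$⟩ʳ i                    ≡⟨ cong (ρ ⟨$⟩ʳ_) (inverseʳ π) ⟨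
    ρ ⟨$⟩ʳ (π ⟨$⟩ʳ (π ⟨$⟩ˡ i))  ≡⟨ at p (π ⟨$⟩ˡ i) ⟩
    σ ⟨$⟩ʳ (π ⟨$⟩ʳ (π ⟨$⟩ˡ i))  ≡⟨ cong (σ ⟨$⟩ʳ_) (inverseʳ π) ⟩
    σ ⟨$⟩ʳ i                    ∎
    where open ≡-Reasoning

  ∘ₚ-cancelʳ : (π : Permutation′ n) {ρ σ : Permutation′ n} → ρ ∘ₚ π ≃ σ ∘ₚ π → ρ ≃ σ
  ∘ₚ-cancelʳ π {ρ} {σ} p = pointwise λ i → begin
    ρ ⟨$⟩ʳ i                    ≡⟨ inverseˡ π ⟨
    π ⟨$⟩ˡ (π ⟨$⟩ʳ (ρ ⟨$⟩ʳ i))  ≡⟨ cong (π ⟨$⟩ˡ_) (at p i) ⟩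
    π ⟨$⟩ˡ (π ⟨$⟩ʳ (σ ⟨$⟩ʳ i))  ≡⟨ inverseˡ π ⟩
    σ ⟨$⟩ʳ i                    ∎
    where open ≡-Reasoning

  ∘ₚ-flipʳ : (π ρ : Permutation′ n) → (π ∘ₚ ρ) ∘ₚ flip ρ ≃ π
  ∘ₚ-flipʳ π ρ = pointwise (λ i → inverseˡ ρ)

  pow-+ : (π : Permutation′ n) → ∀ a b → pow π (a + b) ≃ pow π a ∘ₚ pow π b
  pow-+ π zero    b = ≃-refl
  pow-+ π (suc a) b = pointwise (λ i → at (pow-+ π a b) (π ⟨$⟩ʳ i))

  pow-* : (π : Permutation′ n) → ∀ a b → pow π (a * b) ≃ pow (pow π b) a
  pow-* π zero    b = ≃-refl
  pow-* π (suc a) b = ≃-trans (pow-+ π b (a * b)) (∘ₚ-cong (≃-refl {pow π b}) (pow-* π a b))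

  pow-cong : {π ρ : Permutation′ n} → π ≃ ρ → ∀ j → pow π j ≃ pow ρ j
  pow-cong p zero    = ≃-refl
  pow-cong p (suc j) = ∘ₚ-cong p (pow-cong p j)

  pow-id : ∀ j → pow (id {n}) j ≃ id
  pow-id zero    = ≃-refl
  pow-id (suc j) = pointwise (at (pow-id j))

  pow-multiple : {π : Permutation′ n} {m j : ℕ} → pow π m ≃ id → m ∣ j → pow π j ≃ id
  pow-multiple {π} {m} πᵐ≃1 (divides q refl) =
    ≃-trans (pow-* π q m) (≃-trans (pow-cong πᵐ≃1 q) (pow-id q))

  pow-cancel : (π : Permutation′ n) {i j : ℕ} → i ≤ j → pow π i ≃ pow π j → pow π (j ∸ i) ≃ id
  pow-cancel π {i} {j} i≤j πⁱ≃πʲ = ∘ₚ-cancelˡ (pow π i) (≃-sym (begin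
    pow π i ∘ₚ id                ≈⟨ pointwise (λ _ → refl) ⟩
    pow π i                      ≈⟨ πⁱ≃πʲ ⟩
    pow π j                      ≡⟨ cong (pow π) (m+[n∸m]≡n i≤j) ⟨
    pow π (i + (j ∸ i))          ≈⟨ pow-+ π i (j ∸ i) ⟩
    pow π i ∘ₚ pow π (j ∸ i)     ∎))
    where open import Relation.Binary.Reasoning.Setoid (permSetoid n)

  pow-closed : {H : PermSet n} → IsPermGroup H → {π : Permutation′ n} → H π → ∀ j → H (pow π j)
  pow-closed isGroup π∈H zero    = IsPermGroup.∈-id isGroup
  pow-closed isGroup π∈H (suc j) = IsPermGroup.∈-∘ isGroup π∈H (pow-closed isGroup π∈H j)

  resp-≃ : {H : PermSet n} → IsPermGroup H → {π ρ : Permutation′ n} → π ≃ ρ → H π → H ρ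
  resp-≃ isGroup π≃ρ = IsPermGroup.resp isGroup (at π≃ρ)

  exponent-divides : {H : PermSet n} → IsPermGroup H → {π : Permutation′ n} {m : ℕ} →
    IsLeastPos (λ j → H (pow π j)) m → ∀ j → H (pow π j) → m ∣ j
  exponent-divides {H} isGroup {π} {m@(suc _)} (_ , πᵐ∈H , minimal) j πʲ∈H
    with j % m ≟ 0
  ... | yes r≡0 = m%n≡0⇒n∣m j m r≡0
  ... | no  r≢0 = ⊥-elim (minimal r (n≢0⇒n>0 r≢0) (m%n<n j m) πʳ∈H)
    where
      open IsPermGroup isGroup using (∈-∘; ∈-inv)
      q r : ℕ
      q = j / m
      r = j % m
      πᵠᵐ∈H : H (pow π (q * m))
      πᵠᵐ∈H = resp-≃ isGroup (≃-sym (pow-* π q m)) (pow-closed isGroup πᵐ∈H q)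
      split : pow π j ≃ pow π r ∘ₚ pow π (q * m)
      split = ≃-trans (≡⇒≃ (cong (pow π) (m≡m%n+[m/n]*n j m))) (pow-+ π r (q * m))
      πʳ∈H : H (pow π r)
      πʳ∈H = resp-≃ isGroup
        (≃-trans (∘ₚ-cong split (≃-refl {flip (pow π (q * m))})) (∘ₚ-flipʳ (pow π r) (pow π (q * m))))
        (∈-∘ πʲ∈H (∈-inv πᵠᵐ∈H))

  open import Data.List.Membership.Setoid (permSetoid n) using (_∈_)

  power-collision : (π : Permutation′ n) (xs : List (Permutation′ n)) → (∀ j → pow π j ∈ xs) →
    ∃₂ λ i j → i < j × pow π i ≃ pow π j
  power-collision π xs powers∈xs
    with i , j , i<j , same ← Finₚ.pigeonhole (n<1+n (length xs)) (λ i → Any.index (powers∈xs (toℕ i)))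
    = toℕ i , toℕ j , i<j , index-injective (permSetoid n) (powers∈xs (toℕ i)) (powers∈xs (toℕ j)) same
    where open import Data.List.Membership.Setoid.Properties using (index-injective)

  finite-order : (π : Permutation′ n) (xs : List (Permutation′ n)) → (∀ j → pow π j ∈ xs) → ∃ (Order π)
  finite-order π xs powers∈xs with i , j , i<j , πⁱ≃πʲ ← power-collision π xs powers∈xs =
    leastPositive (λ d → pow π d ≈ₚ id) (λ d → map′ at pointwise (pow π d ≃? id))
      (j ∸ i) (m<n⇒0<n∸m i<j) (at (pow-cancel π (<⇒≤ i<j) πⁱ≃πʲ))

-- The sets ⟨z⟩x = {x, zx, …, z^(t-1)x} have
-- exactly t elements, and a duplicate-free list closed under left
-- translation by z is a disjoint union of such sets; so its length is a
-- multiple of t.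
module Cosets {n : ℕ} {z : Permutation′ n} {t : ℕ} (order : Order z t) where

  open import Data.List.Membership.DecSetoid (permDecSetoid {n}) using (_∈_; _∉_; _∈?_; _∉?_)
  open import Data.List.Membership.Setoid.Properties
    using (∈-resp-≈; ∈-applyUpTo⁺; ∈-applyUpTo⁻; ∈-filter⁺; ∈-filter⁻; ∈-++⁺ˡ; ∈-++⁺ʳ; ∈-++⁻)
  open import Data.List.Relation.Unary.Unique.Setoid (permSetoid n) using (Unique)
  import Data.List.Relation.Unary.Unique.Setoid.Properties as Unique
  open import Data.List.Relation.Binary.Subset.Setoid (permSetoid n) using (_⊆_)
  open Counting (permSetoid n) using (length-cong)

  private
    Perm : Set
    Perm = Permutation′ n
    S : Setoid 0ℓ 0ℓ
    S = permSetoid n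

  0<t : 0 < t
  0<t = proj₁ order

  zᵗ≃1 : pow z t ≃ id
  zᵗ≃1 = pointwise (proj₁ (proj₂ order))

  TranslationClosed : List Perm → Set
  TranslationClosed L = ∀ {w} → w ∈ L → z ∘ₚ w ∈ L

  coset : Perm → List Perm
  coset x = applyUpTo (λ j → pow z j ∘ₚ x) t

  coset-length : ∀ x → length (coset x) ≡ t
  coset-length x = length-applyUpTo _ t

  -- Its entries are distinct because z^j ≠ 1 for 0 < j < t.
  coset-unique : ∀ x → Unique (coset x)
  coset-unique x = Unique.applyUpTo⁺₁ S _ t distinct
    where
      distinct : ∀ {i j} → i < j → j < t → ¬ (pow z i ∘ₚ x ≃ pow z j ∘ₚ x)
      distinct {i} {j} i<j j<t same = proj₂ (proj₂ order) (j ∸ i) (m<n⇒0<n∸m i<j)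
        (≤-<-trans (m∸n≤m j i) j<t) (at (pow-cancel z (<⇒≤ i<j) (∘ₚ-cancelʳ x same)))

  -- Every translate z^a x lies in ⟨z⟩x, since z^a = z^(a mod t).
  coset-complete : ∀ x a → pow z a ∘ₚ x ∈ coset x
  coset-complete x a = ∈-resp-≈ S (≃-sym reduce) (∈-applyUpTo⁺ S _ (m%n<n a t))
    where
      instance
        t≢0 : NonZero t
        t≢0 = >-nonZero 0<t
      reduce : pow z a ∘ₚ x ≃ pow z (a % t) ∘ₚ x
      reduce = ∘ₚ-cong (begin
        pow z a                            ≡⟨ cong (pow z) (m≡m%n+[m/n]*n a t) ⟩
        pow z (a % t + (a / t) * t)        ≈⟨ pow-+ z (a % t) ((a / t) * t) ⟩
        pow z (a % t) ∘ₚ pow z ((a / t) * t)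
          ≈⟨ ∘ₚ-cong (≃-refl {x = pow z (a % t)}) (pow-multiple zᵗ≃1 (divides (a / t) refl)) ⟩
        pow z (a % t) ∘ₚ id                ≈⟨ pointwise (λ _ → refl) ⟩
        pow z (a % t)                      ∎) (≃-refl {x = x})
        where open import Relation.Binary.Reasoning.Setoid S

  coset-closed : ∀ x a {w} → w ∈ coset x → pow z a ∘ₚ w ∈ coset x
  coset-closed x a {w} w∈coset with i , _ , w≃zⁱx ← ∈-applyUpTo⁻ S _ w∈coset =
    ∈-resp-≈ S (≃-sym (begin
      pow z a ∘ₚ w                ≈⟨ ∘ₚ-cong (≃-refl {x = pow z a}) w≃zⁱx ⟩
      pow z a ∘ₚ (pow z i ∘ₚ x)   ≈⟨ pointwise (λ _ → refl) ⟩
      (pow z a ∘ₚ pow z i) ∘ₚ x   ≈⟨ ∘ₚ-cong (≃-sym (pow-+ z a i)) (≃-refl {x = x}) ⟩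
      pow z (a + i) ∘ₚ x          ∎))
      (coset-complete x (a + i))
    where open import Relation.Binary.Reasoning.Setoid S

  -- Conversely w ∈ ⟨z⟩x whenever zw ∈ ⟨z⟩x, because w = z^(t-1)(zw).
  coset-back : ∀ x {w} → z ∘ₚ w ∈ coset x → w ∈ coset x
  coset-back x {w} zw∈coset = ∈-resp-≈ S (begin
    pow z (t ∸ 1) ∘ₚ (z ∘ₚ w)         ≈⟨ pointwise (λ _ → refl) ⟩
    (pow z (t ∸ 1) ∘ₚ pow z 1) ∘ₚ w   ≈⟨ ∘ₚ-cong (≃-sym (pow-+ z (t ∸ 1) 1)) (≃-refl {x = w}) ⟩
    pow z (t ∸ 1 + 1) ∘ₚ w            ≡⟨ cong (λ e → pow z e ∘ₚ w) (m∸n+n≡m 0<t) ⟩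
    pow z t ∘ₚ w                      ≈⟨ ∘ₚ-cong zᵗ≃1 (≃-refl {x = w}) ⟩
    id ∘ₚ w                           ≈⟨ pointwise (λ _ → refl) ⟩
    w                                 ∎)
    (coset-closed x (t ∸ 1) zw∈coset)
    where open import Relation.Binary.Reasoning.Setoid S

  coset-⊆ : ∀ {L x} → TranslationClosed L → x ∈ L → coset x ⊆ L
  coset-⊆ {L} {x} closed x∈L w∈coset with i , _ , w≃zⁱx ← ∈-applyUpTo⁻ S _ w∈coset =
    ∈-resp-≈ S (≃-sym w≃zⁱx) (translates i)
    where
      translates : ∀ i → pow z i ∘ₚ x ∈ L
      translates zero    = ∈-resp-≈ S (pointwise (λ _ → refl)) x∈L
      translates (suc i) = ∈-resp-≈ S (pointwise (λ _ → refl)) (closed (translates i))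

  module Outside {L : List Perm} {x : Perm}
                 (x∈L : x ∈ L) (unique : Unique L) (closed : TranslationClosed L) where

    outside : List Perm
    outside = filter (_∉? coset x) L

    ∉coset-resp : ∀ {w w′} → w ≃ w′ → w ∉ coset x → w′ ∉ coset x
    ∉coset-resp w≃w′ w∉coset w′∈coset = w∉coset (∈-resp-≈ S (≃-sym w≃w′) w′∈coset)

    outside⁻ : ∀ {w} → w ∈ outside → w ∈ L × w ∉ coset x
    outside⁻ = ∈-filter⁻ S (_∉? coset x) ∉coset-resp

    outside⁺ : ∀ {w} → w ∈ L → w ∉ coset x → w ∈ outside
    outside⁺ = ∈-filter⁺ S (_∉? coset x) ∉coset-resp

    outside-unique : Unique outside
    outside-unique = Unique.filter⁺ S (_∉? coset x) unique

    outside-closed : TranslationClosed outside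
    outside-closed w∈outside with w∈L , w∉coset ← outside⁻ w∈outside =
      outside⁺ (closed w∈L) (w∉coset ∘ coset-back x)

    length-outside : length L ≡ t + length outside
    length-outside = begin
      length L                           ≡⟨ length-cong unique split-unique L⊆split split⊆L ⟩
      length (coset x ++ outside)        ≡⟨ length-++ (coset x) ⟩
      length (coset x) + length outside  ≡⟨ cong (_+ length outside) (coset-length x) ⟩
      t + length outside                 ∎
      where
        open ≡-Reasoning
        split-unique : Unique (coset x ++ outside)
        split-unique = Unique.++⁺ S (coset-unique x) outside-unique
          (λ (w∈coset , w∈outside) → proj₂ (outside⁻ w∈outside) w∈coset)
        L⊆split : L ⊆ coset x ++ outside
        L⊆split {w} w∈L with w ∈? coset x
        ... | yes w∈coset = ∈-++⁺ˡ S w∈coset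
        ... | no  w∉coset = ∈-++⁺ʳ S (coset x) (outside⁺ w∈L w∉coset)
        split⊆L : coset x ++ outside ⊆ L
        split⊆L w∈split with ∈-++⁻ S (coset x) w∈split
        ... | inj₁ w∈coset   = coset-⊆ closed x∈L w∈coset
        ... | inj₂ w∈outside = proj₁ (outside⁻ w∈outside)

  -- Lagrange for ⟨z⟩: t divides the length of every duplicate-free,
  -- translation-closed list, by removing one coset at a time.
  divides-length : ∀ L → Unique L → TranslationClosed L → t ∣ length L
  divides-length L = go L (<-wellFounded (length L))
    where
      go : ∀ L → Acc _<_ (length L) → Unique L → TranslationClosed L → t ∣ length L
      go []      _             _      _      = t ∣0
      go (x ∷ L) (acc smaller) unique closed =
        subst (t ∣_) (sym length-outside)
          (∣m∣n⇒∣m+n ∣-refl (go outside (smaller shorter) outside-unique outside-closed))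
        where
          open Outside (Any.here (≃-refl {x = x})) unique closed
          shorter : length outside < length (x ∷ L)
          shorter = subst (length outside <_) (sym length-outside) (m<n+m (length outside) 0<t)

module FiniteGroup {n : ℕ} {H : PermSet n} {k : ℕ} (H-group : IsPermGroup H) (size : HasSize H k) where

  open import Data.List.Membership.Setoid (permSetoid n) using (_∈_)
  open import Data.List.Relation.Unary.Unique.Setoid (permSetoid n) using (Unique)

  elements : List (Permutation′ n)
  elements = proj₁ size

  elements-unique : Unique elements
  elements-unique = AllPairs.map (λ π≉ρ π≃ρ → π≉ρ (at π≃ρ)) (proj₁ (proj₂ (proj₂ size)))

  elements-complete : ∀ {π} → H π → π ∈ elements
  elements-complete {π} π∈H = Any.map pointwise (proj₁ (proj₂ (proj₂ (proj₂ size))) π π∈H)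

  elements-sound : ∀ {π} → π ∈ elements → H π
  elements-sound = All.lookupₛ (permSetoid n) (resp-≃ H-group) (proj₁ (proj₂ size))

  elements-length : length elements ≡ k
  elements-length = proj₂ (proj₂ (proj₂ (proj₂ size)))

  element-order : ∀ {z} → H z → ∃ (Order z)
  element-order {z} z∈H = finite-order z elements (λ j → elements-complete (pow-closed H-group z∈H j))

  order-divides-size : ∀ {z t} → H z → Order z t → t ∣ k
  order-divides-size z∈H order = subst (_ ∣_) elements-length
    (divides-length elements elements-unique
      (λ w∈H → elements-complete (IsPermGroup.∈-∘ H-group z∈H (elements-sound w∈H))))
    where open Cosets order using (divides-length)

module OrbitAction {n : ℕ} {G K : PermSet n} (G-group : IsPermGroup G) (K-group : IsPermGroup K)
                   (faithful : FaithfulOnOrbits K G) where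

  ∈K⇒trivial : ∀ {π} → K π → TrivialOnOrbits K π
  ∈K⇒trivial {π} π∈K x = flip π , IsPermGroup.∈-inv K-group π∈K , inverseˡ π

  orbit-order⇒least-in-K : ∀ {g m} → G g → OrderOnOrbits K g m → IsLeastPos (λ j → K (pow g j)) m
  orbit-order⇒least-in-K {g} {m} g∈G (0<m , gᵐ-trivial , minimal) =
    0<m , faithful _ (pow-closed G-group g∈G m) gᵐ-trivial ,
    λ j 0<j j<m gʲ∈K → minimal j 0<j j<m (∈K⇒trivial gʲ∈K)

  fixing-power∈K : ∀ {g} → G g → SemiregularOnOrbits K g → ∀ i x → pow g i ⟨$⟩ʳ x ≡ x → K (pow g i)
  fixing-power∈K g∈G semiregular i x fixed =
    faithful _ (pow-closed G-group g∈G i) (semiregular i x (id , IsPermGroup.∈-id K-group , fixed))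

module CoprimePower {n : ℕ} {H : PermSet n} (H-group : IsPermGroup H) {g : Permutation′ n} {m t : ℕ}
                    (least-in-H : IsLeastPos (λ j → H (pow g j)) m) (gᵐ-order : Order (pow g m) t)
                    (m⊥t : Coprime m t) where

  h : Permutation′ n
  h = pow g t

  -- h^i ∈ H means g^(i t) ∈ H, so m ∣ i t and hence m ∣ i.
  h-exponents : ∀ i → H (pow h i) → m ∣ i
  h-exponents i hⁱ∈H = coprime-divisor m⊥t (subst (m ∣_) (*-comm i t)
    (exponent-divides H-group least-in-H (i * t) (resp-≃ H-group (≃-sym (pow-* g i t)) hⁱ∈H)))

  hᵐ≃1 : pow h m ≃ id
  hᵐ≃1 = begin
    pow h m            ≈⟨ pow-* g m t ⟨
    pow g (m * t)      ≡⟨ cong (pow g) (*-comm m t) ⟩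
    pow g (t * m)      ≈⟨ pow-* g t m ⟩
    pow (pow g m) t    ≈⟨ pointwise (proj₁ (proj₂ gᵐ-order)) ⟩
    id                 ∎
    where open import Relation.Binary.Reasoning.Setoid (permSetoid n)

  meets-H-trivially : ∀ i → H (pow h i) → pow h i ≃ id
  meets-H-trivially i hⁱ∈H = pow-multiple hᵐ≃1 (h-exponents i hⁱ∈H)

  -- h has order m: h^m = 1, and h^j = 1 ∈ H with 0 < j forces m ∣ j, so j ≥ m.
  h-order : Order h m
  h-order = proj₁ least-in-H , at hᵐ≃1 , λ j 0<j j<m hʲ≈1 →
    <⇒≱ j<m (∣⇒≤ {{>-nonZero 0<j}}
      (h-exponents j (resp-≃ H-group (≃-sym (pointwise hʲ≈1)) (IsPermGroup.∈-id H-group))))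

lemma2p3 : (n : ℕ) (G K : PermSet n) → IsPermGroup G → IsNormalSubgroup K G →
    FaithfulOnOrbits K G →
    (g : Permutation′ n) → G g → SemiregularOnOrbits K g →
    (m : ℕ) → OrderOnOrbits K g m →
    (k : ℕ) → HasSize K k → Coprime m k →
    Σ (Permutation′ n) λ h → G h × Semiregular h × Order h m
lemma2p3 n G K G-group normal faithful g g∈G semiregular m orbit-order k size m⊥k =
  h , pow-closed G-group g∈G t , h-semiregular , h-order
  where
    K-group : IsPermGroup K
    K-group = IsNormalSubgroup.isGroup normal
    open OrbitAction G-group K-group faithful
    open FiniteGroup K-group size

    least-in-K : IsLeastPos (λ j → K (pow g j)) m
    least-in-K = orbit-order⇒least-in-K g∈G orbit-order
    gᵐ∈K : K (pow g m)
    gᵐ∈K = proj₁ (proj₂ least-in-K)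
    t : ℕ
    t = proj₁ (element-order gᵐ∈K)
    gᵐ-order : Order (pow g m) t
    gᵐ-order = proj₂ (element-order gᵐ∈K)
    m⊥t : Coprime m t
    m⊥t (d∣m , d∣t) = m⊥k (d∣m , ∣-trans d∣t (order-divides-size gᵐ∈K gᵐ-order))

    open CoprimePower K-group least-in-K gᵐ-order m⊥t using (h; h-order; meets-H-trivially)
    h-semiregular : Semiregular h
    h-semiregular i x hⁱx≡x = at (meets-H-trivially i (resp-≃ K-group (pow-* g i t)
      (fixing-power∈K g∈G semiregular (i * t) x (trans (at (pow-* g i t) x) hⁱx≡x))))
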